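{- Let $\mathcal{G}$ be a hereditary class of graphs with a finite set of forbidden induced subgraphs. Then the almost-$\mathcal{G}$ class is hereditary and has a finite set of forbidden induced subgraphs.
   Context: All graphs are simple, finite and undirected. A class of graphs is hereditary if it is closed under taking induced subgraphs; a forbidden induced subgraph for it is a graph not in the class all of whose proper induced subgraphs are in the class. A non-edge of $G$ is an edge of its complement. The almost-$\mathcal{G}$ class is the class of graphs $G$ such that $G\in\mathcal{G}$, or $G$ has a vertex $v$ with $G-v\in\mathcal{G}$, or $G$ has an edge $e$ with $G-e\in\mathcal{G}$, or $G$ has a non-edge $e$ with $G+e\in\mathcal{G}$. -}

module Defs where

open import Data.Nat using (ℕ; zero; suc; _<_)
open import Data.Fin using (Fin; punchIn; _≟_)
open import Data.Bool using (Bool; true; false; _∧_; _∨_; _xor_; not)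
open import Data.Bool.Properties using (∧-comm; ∨-comm)
open import Data.List using (List)
open import Data.List.Relation.Unary.Any using (Any)
open import Data.Product using (Σ; _×_; _,_)
open import Data.Sum using (_⊎_)
open import Data.Empty using (⊥-elim)
open import Function.Definitions using (Injective)
open import Relation.Nullary using (¬_; yes; no)
open import Relation.Nullary.Decidable using (⌊_⌋)
open import Relation.Binary.PropositionalEquality using (_≡_; _≢_; refl; sym; trans; cong₂)

record Graph : Set where
  field
    n   : ℕ
    adj : Fin n → Fin n → Bool
    adj-sym : ∀ i j → adj i j ≡ adj j i
    adj-irr : ∀ i → adj i i ≡ false
open Graph public

record _⊑_ (H G : Graph) : Set where
  field
    emb     : Fin (n H) → Fin (n G)
    emb-inj : Injective _≡_ _≡_ emb
    emb-adj : ∀ i j → adj H i j ≡ adj G (emb i) (emb j)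
open _⊑_ public

_⊏_ : Graph → Graph → Set
H ⊏ G = (H ⊑ G) × (n H < n G)

record _≅_ (H G : Graph) : Set where
  field
    to      : H ⊑ G
    from    : Fin (n G) → Fin (n H)
    from-to : ∀ i → from (emb to i) ≡ i
    to-from : ∀ j → emb to (from j) ≡ j
open _≅_ public

GraphClass : Set₁
GraphClass = Graph → Set

Hereditary : GraphClass → Set
Hereditary 𝒢 = ∀ G H → H ⊑ G → 𝒢 G → 𝒢 H

Forbidden : GraphClass → Graph → Set
Forbidden 𝒢 H = ¬ 𝒢 H × (∀ H′ → H′ ⊏ H → 𝒢 H′)

FiniteForbidden : GraphClass → Set
FiniteForbidden 𝒢 = Σ (List Graph) λ L → ∀ H → Forbidden 𝒢 H → Any (λ F → F ≅ H) L

private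
  del : (m : ℕ) (a : Fin m → Fin m → Bool) →
        (∀ i j → a i j ≡ a j i) → (∀ i → a i i ≡ false) → Fin m → Graph
  del (suc m) a s r v = record
    { n = m
    ; adj = λ x y → a (punchIn v x) (punchIn v y)
    ; adj-sym = λ x y → s (punchIn v x) (punchIn v y)
    ; adj-irr = λ x → r (punchIn v x)
    }

deleteVertex : (G : Graph) → Fin (n G) → Graph
deleteVertex G v = del (n G) (adj G) (adj-sym G) (adj-irr G) v

-- Toggling the adjacency of a pair of distinct vertices u ≠ v
-- (deleting the edge uv if it is an edge, adding it if it is a non-edge).

isPair : ∀ {m} → Fin m → Fin m → Fin m → Fin m → Bool
isPair u v x y = (⌊ x ≟ u ⌋ ∧ ⌊ y ≟ v ⌋) ∨ (⌊ x ≟ v ⌋ ∧ ⌊ y ≟ u ⌋)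

private
  isPair-sym : ∀ {m} (u v x y : Fin m) → isPair u v x y ≡ isPair u v y x
  isPair-sym u v x y =
    trans (∨-comm (⌊ x ≟ u ⌋ ∧ ⌊ y ≟ v ⌋) (⌊ x ≟ v ⌋ ∧ ⌊ y ≟ u ⌋))
          (cong₂ _∨_ (∧-comm ⌊ x ≟ v ⌋ ⌊ y ≟ u ⌋) (∧-comm ⌊ x ≟ u ⌋ ⌊ y ≟ v ⌋))

  isPair-irr : ∀ {m} (u v : Fin m) → u ≢ v → ∀ x → isPair u v x x ≡ false
  isPair-irr u v u≢v x with x ≟ u | x ≟ v
  ... | yes refl | yes refl = ⊥-elim (u≢v refl)
  ... | yes _ | no _ = refl
  ... | no _ | yes _ = refl
  ... | no _ | no _ = refl

toggle : (G : Graph) (u v : Fin (n G)) → u ≢ v → Graph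
toggle G u v u≢v = record
  { n = n G
  ; adj = λ x y → adj G x y xor isPair u v x y
  ; adj-sym = λ x y → cong₂ _xor_ (adj-sym G x y) (isPair-sym u v x y)
  ; adj-irr = λ x → cong₂ _xor_ (adj-irr G x) (isPair-irr u v u≢v x)
  }

Almost : GraphClass → GraphClass
Almost 𝒢 G =
  𝒢 G
  ⊎ Σ (Fin (n G)) (λ v → 𝒢 (deleteVertex G v))
  ⊎ Σ (Fin (n G)) (λ u → Σ (Fin (n G)) λ v → Σ (u ≢ v) λ u≢v →
        adj G u v ≡ true × 𝒢 (toggle G u v u≢v))
  ⊎ Σ (Fin (n G)) (λ u → Σ (Fin (n G)) λ v → Σ (u ≢ v) λ u≢v →
        adj G u v ≡ false × 𝒢 (toggle G u v u≢v))

{-# OPTIONS --safe #-}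

-- If every forbidden induced subgraph of 𝒢 has at most M vertices, then every graph outside 𝒢
-- contains an obstruction: an induced subgraph outside 𝒢 on at most M vertices.  Let H be a
-- forbidden induced subgraph of almost-𝒢.  Choose an obstruction O in H, for every vertex a of O
-- an obstruction in H − a, and for every pair a ≠ b of O an obstruction in H with ab toggled.
-- A deletion or toggle not confined to O leaves O intact, so if a vertex w of H lies outside all
-- these (at most M + M² + M³) vertices, they survive in H − w and show that H − w is not
-- almost-𝒢, contradicting the minimality of H.  Hence H has at most M + M² + M³ vertices, and up
-- to isomorphism there are finitely many such graphs.  As 𝒢 need not be decidable, obstructions
-- exist only under double negation; this suffices because the bound on the order is decidable.

module Submission where

open import Defs
open import Data.Bool using (Bool; true; false; _∧_; _∨_; _xor_; not)
open import Data.Bool.Properties using (∧-comm; ∧-zeroʳ; ∧-identityʳ; ∧-idem; xor-identityʳ)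
open import Data.Empty using (⊥-elim)
open import Data.Fin using (Fin; zero; suc; punchIn; punchOut; _≟_)
open import Data.Fin.Properties
  using (punchIn-injective; punchInᵢ≢i; punchIn-punchOut; injective⇒≤; ∀-cons; any?; all?; ¬∀⟶∃¬)
open import Data.List
  using (List; []; _∷_; [_]; _++_; length; map; concat; concatMap; tabulate; lookup; upTo; cartesianProductWith)
open import Data.List.Extrema.Nat using (max; v≤max⁺)
open import Data.List.Properties using (length-++; length-tabulate)
open import Data.List.Membership.Propositional using (_∈_; _∉_)
open import Data.List.Membership.Propositional.Properties
  using (∈-++⁺ˡ; ∈-++⁺ʳ; ∈-concat⁺′; ∈-tabulate⁺)
open import Data.List.Relation.Unary.Any using (Any; here; index)
import Data.List.Relation.Unary.Any as Any
open import Data.List.Relation.Unary.Any.Properties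
  using (lookup-index; cartesianProductWith⁺; concatMap⁺; map⁺; applyUpTo⁺)
open import Data.Nat using (ℕ; zero; suc; _+_; _*_; _≤_; _<_; z≤n; s≤s; _≤?_)
open import Data.Nat.Induction using (<-wellFounded)
open import Data.Nat.Properties
  using (≤-refl; ≤-trans; ≤-reflexive; <⇒≱; n<1+n; +-mono-≤; *-mono-≤; module ≤-Reasoning)
open import Data.Product using (Σ-syntax; ∃; _×_; _,_; proj₁; proj₂)
import Data.Product as Product
open import Data.Sum using (_⊎_; inj₁; inj₂)
import Data.Vec.Functional as Vector
open import Effect.Monad using (RawMonad)
open import Function using (_∘_; id; case_of_)
open import Function.Definitions using (Injective)
open import Induction.WellFounded using (module All)
open import Level using (0ℓ)
open import Relation.Binary.Construct.On using () renaming (wellFounded to on-wellFounded)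
open import Relation.Binary.PropositionalEquality
  using (_≡_; _≢_; refl; sym; trans; cong; cong₂; subst; ≢-sym; _≗_)
open import Relation.Nullary using (¬_; Dec; yes; no)
open import Relation.Nullary.Decidable
  using (⌊_⌋; isYes≗does; dec-true; dec-false; decidable-stable; ¬¬-excluded-middle)
open import Relation.Nullary.Negation using (¬¬-Monad; ¬¬-map; ¬∃⟶∀¬; contradiction)

open RawMonad (¬¬-Monad {0ℓ}) using (_>>=_; return)

¬¬-Π-Fin : ∀ {k} {P : Fin k → Set} → (∀ i → ¬ ¬ P i) → ¬ ¬ (∀ i → P i)
¬¬-Π-Fin {zero}  h = return λ ()
¬¬-Π-Fin {suc k} h = do
  p₀ ← h zero
  ps ← ¬¬-Π-Fin (h ∘ suc)
  return (∀-cons p₀ ps)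

¬¬-→ : ∀ {A B : Set} → (A → ¬ ¬ B) → ¬ ¬ (A → B)
¬¬-→ h ¬f = ¬f λ a → ⊥-elim (h a λ b → ¬f λ _ → b)

covering⇒≤ : ∀ {m} {xs : List (Fin m)} → (∀ v → v ∈ xs) → m ≤ length xs
covering⇒≤ {xs = xs} cover = injective⇒≤ {f = λ v → index (cover v)} index-injective
  where
  index-injective : Injective _≡_ _≡_ (λ v → index (cover v))
  index-injective {v} {w} eq =
    trans (lookup-index (cover v)) (trans (cong (lookup xs) eq) (sym (lookup-index (cover w))))

length-concat-tabulate-≤ : ∀ {A : Set} {k B} (h : Fin k → List A) →
                           (∀ i → length (h i) ≤ B) → length (concat (tabulate h)) ≤ k * B
length-concat-tabulate-≤ {k = zero}  h bound = z≤n
length-concat-tabulate-≤ {k = suc k} h bound =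
  ≤-trans (≤-reflexive (length-++ (h zero)))
          (+-mono-≤ (bound zero) (length-concat-tabulate-≤ (h ∘ suc) (bound ∘ suc)))

∈-concat-tabulate⁺ : ∀ {A : Set} {k} {x : A} (h : Fin k → List A) i →
                     x ∈ h i → x ∈ concat (tabulate h)
∈-concat-tabulate⁺ h i x∈ = ∈-concat⁺′ x∈ (∈-tabulate⁺ i)

functions : ∀ {A : Set} k → List A → List (Fin k → A)
functions zero    xs = [ (λ ()) ]
functions (suc k) xs = cartesianProductWith Vector._∷_ xs (functions k xs)

functions-complete : ∀ {A B : Set} {xs : List A} (R : A → B → Set) →
                     (∀ y → Any (λ x → R x y) xs) →
                     ∀ {k} (h : Fin k → B) → Any (λ f → ∀ i → R (f i) (h i)) (functions k xs)
functions-complete R enum {zero}  h = here λ ()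
functions-complete R enum {suc k} h =
  cartesianProductWith⁺ Vector._∷_ ∀-cons (enum (h zero)) (functions-complete R enum (h ∘ suc))

⊑-refl : ∀ {G} → G ⊑ G
⊑-refl = record { emb = id ; emb-inj = id ; emb-adj = λ i j → refl }

⊑-trans : ∀ {F G H} → F ⊑ G → G ⊑ H → F ⊑ H
⊑-trans E D = record
  { emb     = emb D ∘ emb E
  ; emb-inj = emb-inj E ∘ emb-inj D
  ; emb-adj = λ i j → trans (emb-adj E i j) (emb-adj D (emb E i) (emb E j))
  }

⊑⇒≤ : ∀ {H G} → H ⊑ G → n H ≤ n G
⊑⇒≤ E = injective⇒≤ (emb-inj E)

≅⇒⊒ : ∀ {H G} → H ≅ G → G ⊑ H
≅⇒⊒ {H} {G} iso = record
  { emb     = from iso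
  ; emb-inj = λ {x} {y} eq →
      trans (sym (to-from iso x)) (trans (cong (emb (to iso)) eq) (to-from iso y))
  ; emb-adj = λ i j → sym (trans (emb-adj (to iso) (from iso i) (from iso j))
                                 (cong₂ (adj G) (to-from iso i) (to-from iso j)))
  }

⊑-factor : ∀ {F G G′} (E : F ⊑ G) (D : G′ ⊑ G) → (∀ i → ∃ λ j → emb D j ≡ emb E i) → F ⊑ G′
⊑-factor {G = G} E D lift = record
  { emb     = proj₁ ∘ lift
  ; emb-inj = λ {x} {y} eq →
      emb-inj E (trans (sym (proj₂ (lift x))) (trans (cong (emb D) eq) (proj₂ (lift y))))
  ; emb-adj = λ i j → trans (emb-adj E i j)
      (sym (trans (emb-adj D (proj₁ (lift i)) (proj₁ (lift j)))
                  (cong₂ (adj G) (proj₂ (lift i)) (proj₂ (lift j)))))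
  }

Avoids : ∀ {F G} → F ⊑ G → Fin (n G) → Set
Avoids E v = ∀ i → emb E i ≢ v

image : ∀ {F G} → F ⊑ G → List (Fin (n G))
image E = tabulate (emb E)

∉image⇒avoids : ∀ {F G v} (E : F ⊑ G) → v ∉ image E → Avoids E v
∉image⇒avoids E v∉ i eq = v∉ (subst (_∈ image E) eq (∈-tabulate⁺ i))

preimage? : ∀ {F G} (E : F ⊑ G) v → Dec (∃ λ i → emb E i ≡ v)
preimage? E v = any? (λ i → emb E i ≟ v)

missing-vertex : ∀ {F G} (E : F ⊑ G) → n F < n G → ∃ (Avoids E)
missing-vertex {G = G} E F<G =
  Product.map₂ (∉image⇒avoids E)
               (¬∀⟶∃¬ (n G) (_∈ image E) (λ v → Any.any? (v ≟_) (image E)) not-onto)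
  where
  not-onto : ¬ (∀ v → v ∈ image E)
  not-onto onto = <⇒≱ F<G (≤-trans (covering⇒≤ onto) (≤-reflexive (length-tabulate (emb E))))

-- deleteVertex G v computes only once n G is a successor, which the record pattern exposes.
deleteVertex-⊑ : ∀ {G} v → deleteVertex G v ⊑ G
deleteVertex-⊑ {record { n = suc _ }} v = record
  { emb = punchIn v ; emb-inj = punchIn-injective v _ _ ; emb-adj = λ i j → refl }

deleteVertex-⊑-avoids : ∀ {G} v → Avoids (deleteVertex-⊑ {G} v) v
deleteVertex-⊑-avoids {record { n = suc _ }} v = punchInᵢ≢i v

deleteVertex-⊑-onto : ∀ {G v y} → y ≢ v → ∃ λ x → emb (deleteVertex-⊑ {G} v) x ≡ y
deleteVertex-⊑-onto {record { n = suc _ }} y≢v = punchOut (≢-sym y≢v) , punchIn-punchOut _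

deleteVertex-⊏ : ∀ {G} v → deleteVertex G v ⊏ G
deleteVertex-⊏ {record { n = suc _ }} v = deleteVertex-⊑ v , n<1+n _

⊑-deleteVertex : ∀ {F G v} (E : F ⊑ G) → Avoids E v → F ⊑ deleteVertex G v
⊑-deleteVertex E E∌v = ⊑-factor E (deleteVertex-⊑ _) (deleteVertex-⊑-onto ∘ E∌v)

⊑-deleteVertex² : ∀ {F G w x} (E : F ⊑ G) → Avoids E w → Avoids E (emb (deleteVertex-⊑ w) x) →
                  F ⊑ deleteVertex (deleteVertex G w) x
⊑-deleteVertex² {w = w} E E∌w E∌x = ⊑-deleteVertex (⊑-deleteVertex E E∌w) λ i eq →
  E∌x i (trans (sym (proj₂ (deleteVertex-⊑-onto (E∌w i)))) (cong (emb (deleteVertex-⊑ w)) eq))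

deleteVertex-mono : ∀ {H G} (E : H ⊑ G) i → deleteVertex H i ⊑ deleteVertex G (emb E i)
deleteVertex-mono E i =
  ⊑-deleteVertex (⊑-trans (deleteVertex-⊑ i) E) (λ k → deleteVertex-⊑-avoids i k ∘ emb-inj E)

⊏⇒⊑-deleteVertex : ∀ {Y X} → Y ⊏ X → ∃ λ v → Y ⊑ deleteVertex X v
⊏⇒⊑-deleteVertex (E , Y<X) = Product.map₂ (⊑-deleteVertex E) (missing-vertex E Y<X)

⌊≟⌋-refl : ∀ {m} (i : Fin m) → ⌊ i ≟ i ⌋ ≡ true
⌊≟⌋-refl i = trans (isYes≗does (i ≟ i)) (dec-true (i ≟ i) refl)

⌊≟⌋-≢ : ∀ {m} {i j : Fin m} → i ≢ j → ⌊ i ≟ j ⌋ ≡ false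
⌊≟⌋-≢ {i = i} {j} i≢j = trans (isYes≗does (i ≟ j)) (dec-false (i ≟ j) i≢j)

⌊≟⌋-sym : ∀ {m} (i j : Fin m) → ⌊ i ≟ j ⌋ ≡ ⌊ j ≟ i ⌋
⌊≟⌋-sym i j with i ≟ j
... | yes refl = sym (⌊≟⌋-refl i)
... | no i≢j   = sym (⌊≟⌋-≢ (≢-sym i≢j))

⌊≟⌋-injective : ∀ {a b} {e : Fin a → Fin b} → Injective _≡_ _≡_ e →
                ∀ i j → ⌊ e i ≟ e j ⌋ ≡ ⌊ i ≟ j ⌋
⌊≟⌋-injective inj i j with i ≟ j
... | yes refl = ⌊≟⌋-refl _
... | no i≢j   = ⌊≟⌋-≢ (i≢j ∘ inj)

isPair-≢ˡ : ∀ {m} {u v x y : Fin m} → x ≢ u → y ≢ u → isPair u v x y ≡ false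
isPair-≢ˡ {v = v} {x} x≢u y≢u rewrite ⌊≟⌋-≢ x≢u | ⌊≟⌋-≢ y≢u = ∧-zeroʳ ⌊ x ≟ v ⌋

isPair-≢ʳ : ∀ {m} {u v x y : Fin m} → x ≢ v → y ≢ v → isPair u v x y ≡ false
isPair-≢ʳ {u = u} {x = x} x≢v y≢v rewrite ⌊≟⌋-≢ x≢v | ⌊≟⌋-≢ y≢v =
  cong (_∨ false) (∧-zeroʳ ⌊ x ≟ u ⌋)

isPair-injective : ∀ {a b} {e : Fin a → Fin b} → Injective _≡_ _≡_ e →
                   ∀ u v x y → isPair (e u) (e v) (e x) (e y) ≡ isPair u v x y
isPair-injective inj u v x y =
  cong₂ _∨_ (cong₂ _∧_ (⌊≟⌋-injective inj x u) (⌊≟⌋-injective inj y v))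
            (cong₂ _∧_ (⌊≟⌋-injective inj x v) (⌊≟⌋-injective inj y u))

⊑-toggle : ∀ {F G u v} (E : F ⊑ G) → Avoids E u ⊎ Avoids E v → (q : u ≢ v) → F ⊑ toggle G u v q
⊑-toggle {G = G} E avoids q = record
  { emb     = emb E
  ; emb-inj = emb-inj E
  ; emb-adj = λ i j → trans (emb-adj E i j)
      (sym (trans (cong (adj G (emb E i) (emb E j) xor_) (unpaired avoids i j)) (xor-identityʳ _)))
  }
  where
  unpaired : Avoids E _ ⊎ Avoids E _ → ∀ i j → isPair _ _ (emb E i) (emb E j) ≡ false
  unpaired (inj₁ E∌u) i j = isPair-≢ˡ (E∌u i) (E∌u j)
  unpaired (inj₂ E∌v) i j = isPair-≢ʳ (E∌v i) (E∌v j)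

toggle-mono : ∀ {H G a b} (E : H ⊑ G) (p : a ≢ b) (q : emb E a ≢ emb E b) →
              toggle H a b p ⊑ toggle G (emb E a) (emb E b) q
toggle-mono {a = a} {b} E p q = record
  { emb     = emb E
  ; emb-inj = emb-inj E
  ; emb-adj = λ i j → cong₂ _xor_ (emb-adj E i j) (sym (isPair-injective (emb-inj E) a b i j))
  }

deleteVertex-restrict : ∀ {H G} (E : H ⊑ G) v →
                        H ⊑ deleteVertex G v ⊎ ∃ λ i → deleteVertex H i ⊑ deleteVertex G v
deleteVertex-restrict E v with preimage? E v
... | yes (i , refl) = inj₂ (i , deleteVertex-mono E i)
... | no ∄i          = inj₁ (⊑-deleteVertex E (¬∃⟶∀¬ ∄i))

toggle-restrict : ∀ {H G u v} (E : H ⊑ G) (q : u ≢ v) →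
                  H ⊑ toggle G u v q
                  ⊎ Σ[ a ∈ Fin (n H) ] Σ[ b ∈ Fin (n H) ] Σ[ p ∈ a ≢ b ]
                      adj H a b ≡ adj G u v × toggle H a b p ⊑ toggle G u v q
toggle-restrict {u = u} {v} E q with preimage? E u | preimage? E v
... | no ∄a           | _               = inj₁ (⊑-toggle E (inj₁ (¬∃⟶∀¬ ∄a)) q)
... | yes _           | no ∄b           = inj₁ (⊑-toggle E (inj₂ (¬∃⟶∀¬ ∄b)) q)
... | yes (a , refl) | yes (b , refl) =
  inj₂ (a , b , q ∘ cong (emb E) , emb-adj E a b , toggle-mono E _ q)

¬almost⇒¬toggle : ∀ {𝒢 H u v} → ¬ Almost 𝒢 H → (q : u ≢ v) → ¬ 𝒢 (toggle H u v q)
¬almost⇒¬toggle {H = H} {u} {v} ¬almost q g with adj H u v in uv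
... | true  = ¬almost (inj₂ (inj₂ (inj₁ (u , v , q , uv , g))))
... | false = ¬almost (inj₂ (inj₂ (inj₂ (u , v , q , uv , g))))

module _ {𝒢 : GraphClass} (hereditary : Hereditary 𝒢) where

  deletions⇒proper-subgraphs : ∀ {X} → (∀ v → 𝒢 (deleteVertex X v)) → ∀ Y → Y ⊏ X → 𝒢 Y
  deletions⇒proper-subgraphs X-v∈𝒢 Y Y⊏X =
    let (v , E) = ⊏⇒⊑-deleteVertex Y⊏X in hereditary _ _ E (X-v∈𝒢 v)

  toggle-hereditary : ∀ {H G u v t} (E : H ⊑ G) (q : u ≢ v) → adj G u v ≡ t → 𝒢 (toggle G u v q) →
                      𝒢 H ⊎ Σ[ a ∈ Fin (n H) ] Σ[ b ∈ Fin (n H) ] Σ[ p ∈ a ≢ b ]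
                              adj H a b ≡ t × 𝒢 (toggle H a b p)
  toggle-hereditary E q uv g with toggle-restrict E q
  ... | inj₁ E′                    = inj₁ (hereditary _ _ E′ g)
  ... | inj₂ (a , b , p , ab , E′) = inj₂ (a , b , p , trans ab uv , hereditary _ _ E′ g)

  almost-hereditary : Hereditary (Almost 𝒢)
  almost-hereditary G H E (inj₁ g) = inj₁ (hereditary G H E g)
  almost-hereditary G H E (inj₂ (inj₁ (v , g))) with deleteVertex-restrict E v
  ... | inj₁ E′       = inj₁ (hereditary _ _ E′ g)
  ... | inj₂ (i , E′) = inj₂ (inj₁ (i , hereditary _ _ E′ g))
  almost-hereditary G H E (inj₂ (inj₂ (inj₁ (u , v , q , uv , g)))) with toggle-hereditary E q uv g
  ... | inj₁ h = inj₁ h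
  ... | inj₂ h = inj₂ (inj₂ (inj₁ h))
  almost-hereditary G H E (inj₂ (inj₂ (inj₂ (u , v , q , uv , g)))) with toggle-hereditary E q uv g
  ... | inj₁ h = inj₁ h
  ... | inj₂ h = inj₂ (inj₂ (inj₂ h))

-- Symmetrised and made irreflexive, so that every Boolean matrix yields a graph.
fromMatrix : ∀ m → (Fin m → Fin m → Bool) → Graph
fromMatrix m b = record
  { n       = m
  ; adj     = λ i j → (b i j ∧ b j i) ∧ not ⌊ i ≟ j ⌋
  ; adj-sym = λ i j → cong₂ _∧_ (∧-comm (b i j) (b j i)) (cong not (⌊≟⌋-sym i j))
  ; adj-irr = λ i → trans (cong (λ t → (b i i ∧ b i i) ∧ not t) (⌊≟⌋-refl i)) (∧-zeroʳ _)
  }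

fromMatrix-≅ : ∀ {H b} → (∀ i j → b i j ≡ adj H i j) → fromMatrix (n H) b ≅ H
fromMatrix-≅ {H} {b} b≗adj = record
  { to      = record { emb = id ; emb-inj = id ; emb-adj = same-adj }
  ; from    = id
  ; from-to = λ _ → refl
  ; to-from = λ _ → refl
  }
  where
  same-adj : ∀ i j → (b i j ∧ b j i) ∧ not ⌊ i ≟ j ⌋ ≡ adj H i j
  same-adj i j with i ≟ j
  ... | yes refl = trans (∧-zeroʳ _) (sym (adj-irr H i))
  ... | no _     = trans (∧-identityʳ _)
    (trans (cong₂ _∧_ (b≗adj i j) (trans (b≗adj j i) (adj-sym H j i))) (∧-idem _))

graphsOfOrder : ℕ → List Graph
graphsOfOrder m = map (fromMatrix m) (functions m (functions m (true ∷ false ∷ [])))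

graphsOfOrder-complete : ∀ H → Any (_≅ H) (graphsOfOrder (n H))
graphsOfOrder-complete H =
  map⁺ (Any.map fromMatrix-≅ (functions-complete _≗_ (functions-complete _≡_ bools) (adj H)))
  where
  bools : ∀ t → Any (_≡ t) (true ∷ false ∷ [])
  bools true  = here refl
  bools false = Any.there (here refl)

graphsUpTo : ℕ → List Graph
graphsUpTo N = concatMap graphsOfOrder (upTo (suc N))

graphsUpTo-complete : ∀ {N} H → n H ≤ N → Any (_≅ H) (graphsUpTo N)
graphsUpTo-complete H H≤N =
  concatMap⁺ graphsOfOrder (applyUpTo⁺ id (graphsOfOrder-complete H) (s≤s H≤N))

ForbiddenOrder≤ : GraphClass → ℕ → Set
ForbiddenOrder≤ 𝒢 M = ∀ H → Forbidden 𝒢 H → n H ≤ M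

finiteForbidden⇒bounded : ∀ {𝒢} → FiniteForbidden 𝒢 → ∃ (ForbiddenOrder≤ 𝒢)
finiteForbidden⇒bounded (L , listed) =
  max 0 (map n L) ,
  λ H fb → v≤max⁺ 0 (map n L) (inj₂ (map⁺ (Any.map (⊑⇒≤ ∘ ≅⇒⊒) (listed H fb))))

bounded⇒finiteForbidden : ∀ {𝒢 N} → ForbiddenOrder≤ 𝒢 N → FiniteForbidden 𝒢
bounded⇒finiteForbidden {N = N} bounded =
  graphsUpTo N , λ H fb → graphsUpTo-complete H (bounded H fb)

module _ {𝒢 : GraphClass} (hereditary : Hereditary 𝒢) {M : ℕ} (bounded : ForbiddenOrder≤ 𝒢 M) where

  record Obstruction (G : Graph) : Set where
    field
      graph     : Graph
      embedding : graph ⊑ G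
      small     : n graph ≤ M
      excluded  : ¬ 𝒢 graph

    vertex : Fin (n graph) → Fin (n G)
    vertex = emb embedding

    length-image≤ : length (image embedding) ≤ M
    length-image≤ = ≤-trans (≤-reflexive (length-tabulate vertex)) small

    excludes : ∀ {G′} → graph ⊑ G′ → ¬ 𝒢 G′
    excludes E g = excluded (hereditary _ _ E g)

  open Obstruction

  obstruction-⊑ : ∀ {G G′} → G ⊑ G′ → Obstruction G → Obstruction G′
  obstruction-⊑ D O = record { Obstruction O ; embedding = ⊑-trans (embedding O) D }

  obstruction-toggle : ∀ {G u v} (O : Obstruction G) → Avoids (embedding O) u ⊎ Avoids (embedding O) v →
                       (q : u ≢ v) → Obstruction (toggle G u v q)
  obstruction-toggle O avoids q =
    record { Obstruction O ; embedding = ⊑-toggle (embedding O) avoids q }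

  obstruction-deleteVertex : ∀ {G v} → Obstruction (deleteVertex G v) →
                             Σ[ O ∈ Obstruction G ] Avoids (embedding O) v
  obstruction-deleteVertex {v = v} O =
    obstruction-⊑ (deleteVertex-⊑ v) O , λ i → deleteVertex-⊑-avoids v (vertex O i)

  ¬¬-obstruction : ∀ X → ¬ 𝒢 X → ¬ ¬ Obstruction X
  ¬¬-obstruction =
    All.wfRec (on-wellFounded n <-wellFounded) 0ℓ (λ X → ¬ 𝒢 X → ¬ ¬ Obstruction X) step
    where
    step : ∀ X → (∀ {Y} → n Y < n X → ¬ 𝒢 Y → ¬ ¬ Obstruction Y) → ¬ 𝒢 X → ¬ ¬ Obstruction X
    step X recurse X∉𝒢 = do
      decide ← ¬¬-Π-Fin (λ v → ¬¬-excluded-middle)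
      case all? decide of λ where
        (yes X-v∈𝒢) → return record
          { graph = X ; embedding = ⊑-refl ; excluded = X∉𝒢
          ; small = bounded X (X∉𝒢 , deletions⇒proper-subgraphs hereditary X-v∈𝒢) }
        (no ¬∀v) → let (v , X-v∉𝒢) = ¬∀⟶∃¬ (n X) _ decide ¬∀v in
          ¬¬-map (obstruction-⊑ (deleteVertex-⊑ v)) (recurse (proj₂ (deleteVertex-⊏ v)) X-v∉𝒢)

  ¬almost-deleteVertex : ∀ {H} w →
    (∀ u → Σ[ O ∈ Obstruction H ] Avoids (embedding O) u × Avoids (embedding O) w) →
    (∀ u v (q : u ≢ v) → Σ[ O ∈ Obstruction (toggle H u v q) ] Avoids (embedding O) w) →
    ¬ Almost 𝒢 (deleteVertex H w)
  ¬almost-deleteVertex {H} w deleting toggling = λ where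
      (inj₁ g) → let (O , _ , O∌w) = deleting w in
        excludes O (⊑-deleteVertex (embedding O) O∌w) g
      (inj₂ (inj₁ (x , g))) → let (O , O∌x , O∌w) = deleting (d x) in
        excludes O (⊑-deleteVertex² (embedding O) O∌w O∌x) g
      (inj₂ (inj₂ (inj₁ (x , y , q , _ , g)))) → ¬toggle q g
      (inj₂ (inj₂ (inj₂ (x , y , q , _ , g)))) → ¬toggle q g
    where
    D : deleteVertex H w ⊑ H
    D = deleteVertex-⊑ w

    d : Fin (n (deleteVertex H w)) → Fin (n H)
    d = emb D

    ¬toggle : ∀ {x y} (q : x ≢ y) → ¬ 𝒢 (toggle (deleteVertex H w) x y q)
    ¬toggle {x} {y} q = let (O , O∌w) = toggling (d x) (d y) (q ∘ emb-inj D) in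
      excludes O (⊑-factor (embedding O) (toggle-mono D q _) (deleteVertex-⊑-onto ∘ O∌w))

  record Certificate (H : Graph) : Set where
    field
      core     : Obstruction H
      deleting : ∀ a → Σ[ O ∈ Obstruction H ] Avoids (embedding O) (vertex core a)
      -- q is stored rather than computed from a ≢ b so that the field is a non-dependent
      -- function of a ≢ b, which is what ¬¬-→ produces.
      toggling : ∀ a b → a ≢ b → Σ[ q ∈ vertex core a ≢ vertex core b ]
                   Obstruction (toggle H (vertex core a) (vertex core b) q)

    deletingImage : Fin (n (graph core)) → List (Fin (n H))
    deletingImage = image ∘ embedding ∘ proj₁ ∘ deleting

    togglingImage : Fin (n (graph core)) → Fin (n (graph core)) → List (Fin (n H))
    togglingImage a b with a ≟ b
    ... | yes _   = []
    ... | no a≢b = image (embedding (proj₂ (toggling a b a≢b)))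

    togglingRow : Fin (n (graph core)) → List (Fin (n H))
    togglingRow a = concat (tabulate (togglingImage a))

    coreImage deletingImages togglingImages support : List (Fin (n H))
    coreImage      = image (embedding core)
    deletingImages = concat (tabulate deletingImage)
    togglingImages = concat (tabulate togglingRow)
    support        = (coreImage ++ deletingImages) ++ togglingImages

    length-support≤ : length support ≤ M + M * M + M * (M * M)
    length-support≤ = begin
      length ((coreImage ++ deletingImages) ++ togglingImages)
        ≡⟨ length-++ (coreImage ++ deletingImages) ⟩
      length (coreImage ++ deletingImages) + length togglingImages
        ≡⟨ cong (_+ length togglingImages) (length-++ coreImage) ⟩
      length coreImage + length deletingImages + length togglingImages
        ≤⟨ +-mono-≤ (+-mono-≤ (length-image≤ core) length-deletingImages≤) length-togglingImages≤ ⟩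
      M + M * M + M * (M * M) ∎
      where
      open ≤-Reasoning

      length-togglingImage≤ : ∀ a b → length (togglingImage a b) ≤ M
      length-togglingImage≤ a b with a ≟ b
      ... | yes _   = z≤n
      ... | no a≢b = length-image≤ (proj₂ (toggling a b a≢b))

      length-deletingImages≤ : length deletingImages ≤ M * M
      length-deletingImages≤ =
        ≤-trans (length-concat-tabulate-≤ deletingImage (length-image≤ ∘ proj₁ ∘ deleting))
                (*-mono-≤ (small core) ≤-refl)

      length-togglingImages≤ : length togglingImages ≤ M * (M * M)
      length-togglingImages≤ =
        ≤-trans (length-concat-tabulate-≤ togglingRow
                   (λ a → length-concat-tabulate-≤ (togglingImage a) (length-togglingImage≤ a)))
                (*-mono-≤ (small core) (*-mono-≤ (small core) ≤-refl))

    ∉support⇒¬almost : ∀ {w} → w ∉ support → ¬ Almost 𝒢 (deleteVertex H w)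
    ∉support⇒¬almost {w} w∉ = ¬almost-deleteVertex w deleting′ toggling′
      where
      core∌w : Avoids (embedding core) w
      core∌w = ∉image⇒avoids (embedding core) (w∉ ∘ ∈-++⁺ˡ ∘ ∈-++⁺ˡ)

      deleting′ : ∀ u → Σ[ O ∈ Obstruction H ] Avoids (embedding O) u × Avoids (embedding O) w
      deleting′ u with preimage? (embedding core) u
      ... | no ∄a          = core , ¬∃⟶∀¬ ∄a , core∌w
      ... | yes (a , refl) = let (O , O∌u) = deleting a in
        O , O∌u , ∉image⇒avoids (embedding O)
                    (w∉ ∘ ∈-++⁺ˡ ∘ ∈-++⁺ʳ coreImage ∘ ∈-concat-tabulate⁺ deletingImage a)

      toggling-core : ∀ a b (q : vertex core a ≢ vertex core b) → w ∉ togglingImage a b →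
                      Σ[ O ∈ Obstruction (toggle H (vertex core a) (vertex core b) q) ] Avoids (embedding O) w
      toggling-core a b q with a ≟ b
      ... | yes refl = contradiction refl q
      ... | no a≢b   = λ w∉ab → let (_ , O) = toggling a b a≢b in
        -- toggle G u v p and toggle G u v q differ only in their irreflexivity proofs.
        obstruction-⊑ (toggle-mono ⊑-refl _ q) O , ∉image⇒avoids (embedding O) w∉ab

      toggling′ : ∀ u v (q : u ≢ v) → Σ[ O ∈ Obstruction (toggle H u v q) ] Avoids (embedding O) w
      toggling′ u v q with preimage? (embedding core) u | preimage? (embedding core) v
      ... | no ∄a          | _              = obstruction-toggle core (inj₁ (¬∃⟶∀¬ ∄a)) q , core∌w
      ... | yes _          | no ∄b          = obstruction-toggle core (inj₂ (¬∃⟶∀¬ ∄b)) q , core∌w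
      ... | yes (a , refl) | yes (b , refl) = toggling-core a b q
        (w∉ ∘ ∈-++⁺ʳ (coreImage ++ deletingImages) ∘ ∈-concat-tabulate⁺ togglingRow a
            ∘ ∈-concat-tabulate⁺ (togglingImage a) b)

  ¬¬-certificate : ∀ {H} → ¬ Almost 𝒢 H → ¬ ¬ Certificate H
  ¬¬-certificate {H} ¬almost = do
    core ← ¬¬-obstruction H (¬almost ∘ inj₁)
    deleting ← ¬¬-Π-Fin λ a →
      ¬¬-map obstruction-deleteVertex (¬¬-obstruction _ (¬almost ∘ inj₂ ∘ inj₁ ∘ (vertex core a ,_)))
    toggling ← ¬¬-Π-Fin λ a → ¬¬-Π-Fin λ b → ¬¬-→ λ a≢b →
      let q = a≢b ∘ emb-inj (embedding core) in
      ¬¬-map (q ,_) (¬¬-obstruction _ (¬almost⇒¬toggle {𝒢} ¬almost q))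
    return record { core = core ; deleting = deleting ; toggling = toggling }

  almost-forbiddenOrder≤ : ForbiddenOrder≤ (Almost 𝒢) (M + M * M + M * (M * M))
  almost-forbiddenOrder≤ H (¬almost , minimal) = decidable-stable (n H ≤? _) do
    C ← ¬¬-certificate ¬almost
    let open Certificate C
    return (≤-trans (covering⇒≤ (λ w → decidable-stable (Any.any? (w ≟_) support)
                                   (λ w∉ → ∉support⇒¬almost w∉ (minimal _ (deleteVertex-⊏ w)))))
                    length-support≤)

corollary2p7 : (𝒢 : GraphClass) → Hereditary 𝒢 → FiniteForbidden 𝒢 →
    Hereditary (Almost 𝒢) × FiniteForbidden (Almost 𝒢)
corollary2p7 𝒢 hereditary finite =
  almost-hereditary hereditary ,
  bounded⇒finiteForbidden (almost-forbiddenOrder≤ hereditary (proj₂ (finiteForbidden⇒bounded finite)))
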